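{- Let $\mathbb{F}_q$ be a finite field of characteristic $p$. Let $A,B\in\mathbb{F}_q[x]$ be additive polynomials such that $A(B(\alpha))=B(A(\alpha))$ for all $\alpha\in\mathbb{F}_q$, let $g\in\mathbb{F}_q[x]$ be arbitrary, and put $f(x):=A(x)+g(B(x))$. Then $f$ permutes $\mathbb{F}_q$ if and only if $A$ permutes $\ker B$ and $A(x)+B(g(x))$ permutes $\operatorname{im}B$.
   Context: An additive polynomial over $\mathbb{F}_q$ (of characteristic $p$) is a polynomial of the form $\sum_{i=0}^k a_i x^{p^i}$ with $a_i\in\mathbb{F}_q$. For a polynomial $B$, $\operatorname{im}B$ and $\ker B$ denote the image and kernel of the induced map $\mathbb{F}_q\to\mathbb{F}_q$. A polynomial permutes a set $S\subseteq\mathbb{F}_q$ if it induces a bijection $S\to S$. -}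

module Defs where

open import Level using (0ℓ)
open import Data.Nat using (ℕ; zero; suc; _^_)
open import Data.Nat.Primality using (Prime)
open import Data.Fin using (Fin)
open import Data.List using (List; []; _∷_)
open import Data.Product using (Σ; ∃; _×_; _,_)
open import Relation.Binary.PropositionalEquality using (_≡_)
open import Relation.Nullary using (¬_)
open import Algebra.Structures using (IsCommutativeRing)
open import Function.Bundles using (Bijection)
open import Relation.Binary.PropositionalEquality using (setoid)

ntimes : {C : Set} → (C → C → C) → C → ℕ → C → C
ntimes _+_ e zero    x = e
ntimes _+_ e (suc n) x = x + ntimes _+_ e n x

record FiniteField : Set₁ where
  infixl 6 _+_
  infixl 7 _*_
  field
    Carrier : Set
    _+_ _*_ : Carrier → Carrier → Carrier
    -_      : Carrier → Carrier
    0# 1#   : Carrier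
    isCommutativeRing : IsCommutativeRing _≡_ _+_ _*_ -_ 0# 1#
    0≢1     : ¬ (0# ≡ 1#)
    inverse : ∀ x → ¬ (x ≡ 0#) → ∃ λ y → x * y ≡ 1#
    q       : ℕ
    enum    : Bijection (setoid (Fin q)) (setoid Carrier)
    p       : ℕ
    p-prime : Prime p

    char-p : ntimes _+_ 0# p 1# ≡ 0#

module _ (F : FiniteField) where
  open FiniteField F

  pow : Carrier → ℕ → Carrier
  pow x n = ntimes _*_ 1# n x

  -- A polynomial in F[x], given by its coefficient list [c₀, c₁, …, c_n]
  -- (representing c₀ + c₁ x + … + c_n xⁿ).
  Poly : Set
  Poly = List Carrier

  eval : Poly → Carrier → Carrier
  eval []       x = 0#
  eval (c ∷ cs) x = c + x * eval cs x

  -- An additive polynomial Σ_{i=0}^k a_i x^{p^i}, given by [a₀, …, a_k].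
  AddPoly : Set
  AddPoly = List Carrier

  evalAddAux : ℕ → AddPoly → Carrier → Carrier
  evalAddAux i []       x = 0#
  evalAddAux i (a ∷ as) x = a * pow x (p ^ i) + evalAddAux (suc i) as x

  evalAdd : AddPoly → Carrier → Carrier
  evalAdd = evalAddAux 0

  ker : AddPoly → Carrier → Set
  ker B x = evalAdd B x ≡ 0#

  im : AddPoly → Carrier → Set
  im B y = ∃ λ x → evalAdd B x ≡ y

  Permutes : (Carrier → Set) → (Carrier → Carrier) → Set
  Permutes S h =
    (∀ x → S x → S (h x)) ×
    (∀ x y → S x → S y → h x ≡ h y → x ≡ y) ×
    (∀ y → S y → ∃ λ x → S x × h x ≡ y)

  whole : Carrier → Set
  whole _ = Data.Unit.⊤
    where import Data.Unit

{-# OPTIONS --safe #-}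
-- Since A and B commute and B is additive, B ∘ f = h ∘ B for h y = A y + B (g y): f maps each
-- coset x + ker B into the fibre of B over h (B x), and on it f x' = f x + A (x' - x). Hence f is
-- injective iff h is injective on im B and A is injective on ker B, while surjectivity of f gives
-- surjectivity of h on im B. On a finite set an invariant map is injective iff it is surjective,
-- which turns these into the permutation statements. Additivity of x ↦ x ^ (p ^ i) is the
-- freshman's dream: p divides the inner binomial coefficients p C k.
module Submission where

open import Defs
open import Level using (0ℓ)
open import Data.Nat as ℕ using (ℕ; zero; suc; _∸_; _<_; _!)
open import Data.Nat.Properties using (_!*_!≢0; <⇒≤; <⇒≱; n<1+n; <-trans; ∸-monoʳ-<; n∸n≡0)
open import Data.Nat.Divisibility using (_∣_; divides; ∣1⇒≡1; ∣⇒≤; m∣m*n)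
open import Data.Nat.DivMod using (_/_; m/n*n≡m)
open import Data.Nat.Primality using (Prime; euclidsLemma)
open import Data.Nat.Combinatorics using (_C_; nCk≡n!/k![n-k]!; k![n∸k]!∣n!; nCn≡1)
open import Data.Fin as Fin using (Fin; toℕ; fromℕ; inject₁; punchOut)
open import Data.Fin.Properties as Fin using (pigeonhole; punchOut-injective; toℕ-fromℕ; toℕ-inject₁; toℕ<n)
open import Data.List using ([]; _∷_)
open import Data.Vec.Functional using (tail; init; last; replicate)
open import Data.Product using (∃; _×_; _,_; proj₁; proj₂)
open import Data.Sum using ([_,_]′; fromInj₁)
open import Data.Unit using (tt)
open import Data.Empty using (⊥-elim)
open import Function using (_∘_)
open import Function.Bundles using (_⇔_; mk⇔; Bijection)
open import Function.Definitions using (Injective; StrictlySurjective)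
open import Relation.Nullary using (¬_; Dec; yes; no; contradiction)
open import Relation.Nullary.Decidable using (map′)
open import Relation.Unary using (Pred; Decidable)
open import Relation.Binary.Definitions using (DecidableEquality)
open import Relation.Binary.PropositionalEquality as ≡ using (_≡_)
open import Algebra.Bundles using (CommutativeSemiring; CommutativeRing)

module _ where
  open import Data.Nat using (_*_)
  open ≡ using (refl; sym; cong; subst)

  p∤m! : ∀ {p} → Prime p → ∀ {m} → m < p → ¬ (p ∣ m !)
  p∤m! p-prime {zero}  _   p∣1 with ∣1⇒≡1 p∣1
  ... | refl = contradiction p-prime λ ()
  p∤m! p-prime {suc m} m<p p∣[1+m]! =
    [ <⇒≱ m<p ∘ ∣⇒≤ , p∤m! p-prime (<-trans (n<1+n m) m<p) ]′ (euclidsLemma (suc m) (m !) p-prime p∣[1+m]!)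

  p∤m!*n! : ∀ {p m n} → Prime p → m < p → n < p → ¬ (p ∣ m ! * n !)
  p∤m!*n! {m = m} {n} p-prime m<p n<p p∣m!*n! =
    [ p∤m! p-prime m<p , p∤m! p-prime n<p ]′ (euclidsLemma (m !) (n !) p-prime p∣m!*n!)

  nCk*[k!*[n∸k]!]≡n! : ∀ {n k} → k ℕ.≤ n → (n C k) * (k ! * (n ∸ k) !) ≡ n !
  nCk*[k!*[n∸k]!]≡n! {n} {k} k≤n = begin
    (n C k) * (k ! * (n ∸ k) !)                    ≡⟨ cong (_* (k ! * (n ∸ k) !)) (nCk≡n!/k![n-k]! k≤n) ⟩
    (n ! / (k ! * (n ∸ k) !)) * (k ! * (n ∸ k) !)  ≡⟨ m/n*n≡m (k![n∸k]!∣n! k≤n) ⟩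
    n !                                            ∎
    where
      open ≡.≡-Reasoning
      instance _ = k !* (n ∸ k) !≢0

  p∣pCk : ∀ {p k} → Prime p → 0 < k → k < p → p ∣ p C k
  p∣pCk {p} {k} p-prime 0<k k<p =
    fromInj₁ (⊥-elim ∘ p∤m!*n! p-prime k<p (∸-monoʳ-< 0<k (<⇒≤ k<p)))
             (euclidsLemma (p C k) (k ! * (p ∸ k) !) p-prime p∣pCk*[k!*[p∸k]!])
    where
      p∣p! : ∀ {n} → Prime n → n ∣ n !
      p∣p! {suc n} _ = m∣m*n (n !)
      p∣pCk*[k!*[p∸k]!] : p ∣ (p C k) * (k ! * (p ∸ k) !)
      p∣pCk*[k!*[p∸k]!] = subst (p ∣_) (sym (nCk*[k!*[n∸k]!]≡n! (<⇒≤ k<p))) (p∣p! p-prime)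

module Frobenius {a ℓ} (S : CommutativeSemiring a ℓ) where
  open CommutativeSemiring S
  open import Algebra.Properties.Semiring.Mult semiring
    using (×-congʳ; ×-assoc-*; ×1-homo-*) renaming (_×_ to _·_)
  open import Algebra.Properties.Semiring.Exp semiring using (_^_; ^-congˡ; ^-assocʳ)
  open import Algebra.Properties.Semiring.Sum semiring using (sum; sum-cong-≋; sum-init-last; sum-replicate-zero)
  open import Algebra.Properties.CommutativeSemiring.Binomial S using (binomialTerm; theorem)
  open import Relation.Binary.Reasoning.Setoid setoid

  module _ {n : ℕ} (n·1≈0 : n · 1# ≈ 0#) where

    ∣⇒·≈0 : ∀ {c} → n ∣ c → ∀ x → c · x ≈ 0#
    ∣⇒·≈0 (divides d ≡.refl) x = begin
      (d ℕ.* n) · x               ≈⟨ ×-congʳ (d ℕ.* n) (*-identityˡ x) ⟨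
      (d ℕ.* n) · (1# * x)        ≈⟨ ×-assoc-* (d ℕ.* n) 1# x ⟨
      ((d ℕ.* n) · 1#) * x        ≈⟨ *-congʳ (×1-homo-* d n) ⟩
      ((d · 1#) * (n · 1#)) * x   ≈⟨ *-congʳ (*-congˡ n·1≈0) ⟩
      ((d · 1#) * 0#) * x         ≈⟨ *-congʳ (zeroʳ (d · 1#)) ⟩
      0# * x                      ≈⟨ zeroˡ x ⟩
      0#                          ∎

  ^-distrib-+-prime : ∀ {p} → Prime p → p · 1# ≈ 0# → ∀ x y → (x + y) ^ p ≈ x ^ p + y ^ p
  ^-distrib-+-prime {suc (suc m)} p-prime p·1≈0 x y = begin
    (x + y) ^ p                                    ≈⟨ theorem p x y ⟩
    t Fin.zero + sum (tail t)                      ≈⟨ +-congˡ (sum-init-last (tail t)) ⟩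
    t Fin.zero + (sum (init (tail t)) + last (tail t)) ≈⟨ +-cong first (+-cong middle final) ⟩
    y ^ p + (0# + x ^ p)                           ≈⟨ +-congˡ (+-identityˡ (x ^ p)) ⟩
    y ^ p + x ^ p                                  ≈⟨ +-comm (y ^ p) (x ^ p) ⟩
    x ^ p + y ^ p                                  ∎
    where
      p = suc (suc m)
      t = binomialTerm x y p

      first : t Fin.zero ≈ y ^ p
      first = trans (+-identityʳ _) (*-identityˡ _)

      middle-vanishes : ∀ i → init (tail t) i ≈ replicate (suc m) 0# i
      middle-vanishes i = ∣⇒·≈0 p·1≈0 (p∣pCk p-prime (ℕ.s≤s ℕ.z≤n) k<p) _
        where
          k<p : suc (toℕ (inject₁ i)) < p
          k<p = ℕ.s≤s (≡.subst (_< suc m) (≡.sym (toℕ-inject₁ i)) (toℕ<n i))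

      middle : sum (init (tail t)) ≈ 0#
      middle = trans (sum-cong-≋ middle-vanishes) (sum-replicate-zero (suc m))

      final : last (tail t) ≈ x ^ p
      final = begin
        (p C toℕ (fromℕ p)) · (x ^ toℕ (fromℕ p) * y ^ (p ∸ toℕ (fromℕ p)))
          ≡⟨ ≡.cong (λ k → (p C k) · (x ^ k * y ^ (p ∸ k))) (toℕ-fromℕ p) ⟩
        (p C p) · (x ^ p * y ^ (p ∸ p))
          ≡⟨ ≡.cong₂ (λ c e → c · (x ^ p * y ^ e)) (nCn≡1 p) (n∸n≡0 p) ⟩
        1 · (x ^ p * 1#)   ≈⟨ +-identityʳ _ ⟩
        x ^ p * 1#         ≈⟨ *-identityʳ _ ⟩
        x ^ p              ∎

  ^-distrib-+-prime^ : ∀ {p} → Prime p → p · 1# ≈ 0# → ∀ i x y →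
                       (x + y) ^ (p ℕ.^ i) ≈ x ^ (p ℕ.^ i) + y ^ (p ℕ.^ i)
  ^-distrib-+-prime^ p-prime p·1≈0 zero x y = distribʳ 1# x y
  ^-distrib-+-prime^ {p} p-prime p·1≈0 (suc i) x y = begin
    (x + y) ^ (p ℕ.* p ℕ.^ i)                  ≈⟨ ^-assocʳ (x + y) p (p ℕ.^ i) ⟨
    ((x + y) ^ p) ^ (p ℕ.^ i)                  ≈⟨ ^-congˡ (p ℕ.^ i) (^-distrib-+-prime p-prime p·1≈0 x y) ⟩
    (x ^ p + y ^ p) ^ (p ℕ.^ i)                ≈⟨ ^-distrib-+-prime^ p-prime p·1≈0 i (x ^ p) (y ^ p) ⟩
    (x ^ p) ^ (p ℕ.^ i) + (y ^ p) ^ (p ℕ.^ i)  ≈⟨ +-cong (^-assocʳ x p (p ℕ.^ i)) (^-assocʳ y p (p ℕ.^ i)) ⟩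
    x ^ (p ℕ.* p ℕ.^ i) + y ^ (p ℕ.* p ℕ.^ i)  ∎

module _ {X : Set} where

  MapsTo : Pred X 0ℓ → (X → X) → Set
  MapsTo S h = ∀ x → S x → S (h x)

  InjectiveOn : Pred X 0ℓ → (X → X) → Set
  InjectiveOn S h = ∀ x y → S x → S y → h x ≡ h y → x ≡ y

  SurjectiveOn : Pred X 0ℓ → (X → X) → Set
  SurjectiveOn S h = ∀ y → S y → ∃ λ x → S x × h x ≡ y

-- A value y missed by f would let f, punched out at y, inject Fin (1 + n) into Fin n.
Fin-injective⇒surjective : ∀ {n} {f : Fin n → Fin n} → Injective _≡_ _≡_ f → StrictlySurjective _≡_ f
Fin-injective⇒surjective {suc n} {f} f-injective y with Fin.any? (λ x → f x Fin.≟ y)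
... | yes hit  = hit
... | no  miss =
  let i , j , i<j , eq = pigeonhole (n<1+n n) (λ x → punchOut (y≢f x))
  in  contradiction (f-injective (punchOut-injective (y≢f i) (y≢f j) eq)) (Fin.<⇒≢ i<j)
  where
    y≢f : ∀ x → y ≡.≢ f x
    y≢f x y≡fx = miss (x , ≡.sym y≡fx)

module FiniteType {X : Set} {q : ℕ} (enum : Bijection (≡.setoid (Fin q)) (≡.setoid X)) where
  open ≡ using (refl; sym; trans; cong; subst)
  open Bijection enum using (to; to⁻; injective; strictlySurjective)

  to∘to⁻ : ∀ x → to (to⁻ x) ≡ x
  to∘to⁻ x = proj₂ (strictlySurjective x)

  to⁻-injective : Injective _≡_ _≡_ to⁻
  to⁻-injective {x} {y} eq = trans (sym (to∘to⁻ x)) (trans (cong to eq) (to∘to⁻ y))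

  _≟_ : DecidableEquality X
  x ≟ y = map′ to⁻-injective (cong to⁻) (to⁻ x Fin.≟ to⁻ y)

  any? : ∀ {P : Pred X 0ℓ} → Decidable P → Dec (∃ P)
  any? {P} P? = map′ (λ (i , Pi) → to i , Pi)
                     (λ (x , Px) → to⁻ x , subst P (sym (to∘to⁻ x)) Px)
                     (Fin.any? (P? ∘ to))

  injective⇒surjective : ∀ {h : X → X} → Injective _≡_ _≡_ h → StrictlySurjective _≡_ h
  injective⇒surjective {h} h-injective x =
    let i , eq = Fin-injective⇒surjective (injective ∘ h-injective ∘ to⁻-injective) (to⁻ x)
    in  to i , to⁻-injective eq

  -- A right inverse r of h is injective, hence surjective, hence a two-sided inverse of h.
  surjective⇒injective : ∀ {h : X → X} → StrictlySurjective _≡_ h → Injective _≡_ _≡_ h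
  surjective⇒injective {h} h-surjective {x} {y} hx≡hy =
    let a , ra≡x = r-surjective x
        b , rb≡y = r-surjective y
        a≡b : a ≡ b
        a≡b = begin
          a        ≡⟨ h∘r a ⟨
          h (r a)  ≡⟨ cong h ra≡x ⟩
          h x      ≡⟨ hx≡hy ⟩
          h y      ≡⟨ cong h rb≡y ⟨
          h (r b)  ≡⟨ h∘r b ⟩
          b        ∎
    in  trans (sym ra≡x) (trans (cong r a≡b) rb≡y)
    where
      open ≡.≡-Reasoning
      r : X → X
      r x = proj₁ (h-surjective x)
      h∘r : ∀ x → h (r x) ≡ x
      h∘r x = proj₂ (h-surjective x)
      r-surjective : StrictlySurjective _≡_ r
      r-surjective = injective⇒surjective λ {a} {b} ra≡rb →
        trans (sym (h∘r a)) (trans (cong h ra≡rb) (h∘r b))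

  module _ {S : Pred X 0ℓ} (S? : Decidable S) {h : X → X} (h-mapsTo : MapsTo S h) where

    -- Extending h by the identity off S transfers injectivity and surjectivity between S and X.
    extendById : X → X
    extendById x with S? x
    ... | yes _ = h x
    ... | no  _ = x

    extendById-on : ∀ {x} → S x → extendById x ≡ h x
    extendById-on {x} Sx with S? x
    ... | yes _  = refl
    ... | no ¬Sx = contradiction Sx ¬Sx

    extendById-off : ∀ {x} → ¬ S x → extendById x ≡ x
    extendById-off {x} ¬Sx with S? x
    ... | yes Sx = contradiction Sx ¬Sx
    ... | no  _  = refl

    extendById-fiber : ∀ {x y} → S y → extendById x ≡ y → S x × h x ≡ y
    extendById-fiber {x} Sy eq with S? x
    ... | yes Sx = Sx , eq
    ... | no ¬Sx = contradiction (subst S (sym eq) Sy) ¬Sx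

    extendById-injective : InjectiveOn S h → Injective _≡_ _≡_ extendById
    extendById-injective h-injective {x} {y} eq with S? x | S? y
    ... | yes Sx | yes Sy = h-injective x y Sx Sy eq
    ... | yes Sx | no ¬Sy = contradiction (subst S eq (h-mapsTo x Sx)) ¬Sy
    ... | no ¬Sx | yes Sy = contradiction (subst S (sym eq) (h-mapsTo y Sy)) ¬Sx
    ... | no _   | no _   = eq

    extendById-surjective : SurjectiveOn S h → StrictlySurjective _≡_ extendById
    extendById-surjective h-surjective y with S? y
    ... | yes Sy = let x , Sx , hx≡y = h-surjective y Sy in x , trans (extendById-on Sx) hx≡y
    ... | no ¬Sy = y , extendById-off ¬Sy

    injectiveOn⇒surjectiveOn : InjectiveOn S h → SurjectiveOn S h
    injectiveOn⇒surjectiveOn h-injective y Sy =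
      let x , eq = injective⇒surjective (extendById-injective h-injective) y
      in  x , extendById-fiber Sy eq

    surjectiveOn⇒injectiveOn : SurjectiveOn S h → InjectiveOn S h
    surjectiveOn⇒injectiveOn h-surjective x y Sx Sy hx≡hy =
      surjective⇒injective (extendById-surjective h-surjective)
        (trans (extendById-on Sx) (trans hx≡hy (sym (extendById-on Sy))))

module AdditivePolynomials (F : FiniteField) where
  open FiniteField F using (Carrier; _+_; _*_; -_; 0#; 1#; isCommutativeRing; p; p-prime; char-p)
  open ≡ using (refl; sym; trans; cong; cong₂)
  open ≡.≡-Reasoning

  commutativeRing : CommutativeRing 0ℓ 0ℓ
  commutativeRing = record
    { _+_ = _+_ ; _*_ = _*_ ; -_ = -_ ; 0# = 0# ; 1# = 1# ; isCommutativeRing = isCommutativeRing }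

  open CommutativeRing commutativeRing
    using (semiring; commutativeSemiring; +-group; +-commutativeSemigroup; +-identityˡ; distribˡ)
  open import Algebra.Properties.Semiring.Mult semiring using () renaming (_×_ to _·_)
  open import Algebra.Properties.Semiring.Exp semiring using (_^_)
  open import Algebra.Properties.Group +-group using (identityˡ-unique; //-rightDividesˡ)
  open import Algebra.Properties.CommutativeSemigroup +-commutativeSemigroup using (interchange)
  open Frobenius commutativeSemiring using (^-distrib-+-prime^)

  pow≡^ : ∀ x n → pow F x n ≡ x ^ n
  pow≡^ x zero    = refl
  pow≡^ x (suc n) = cong (x *_) (pow≡^ x n)

  ntimes≡· : ∀ n x → ntimes _+_ 0# n x ≡ n · x
  ntimes≡· zero    x = refl
  ntimes≡· (suc n) x = cong (x +_) (ntimes≡· n x)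

  pow-p^-distrib-+ : ∀ i x y → pow F (x + y) (p ℕ.^ i) ≡ pow F x (p ℕ.^ i) + pow F y (p ℕ.^ i)
  pow-p^-distrib-+ i x y = begin
    pow F (x + y) (p ℕ.^ i)                   ≡⟨ pow≡^ (x + y) (p ℕ.^ i) ⟩
    (x + y) ^ (p ℕ.^ i)                       ≡⟨ ^-distrib-+-prime^ p-prime p·1≡0 i x y ⟩
    x ^ (p ℕ.^ i) + y ^ (p ℕ.^ i)             ≡⟨ cong₂ _+_ (pow≡^ x (p ℕ.^ i)) (pow≡^ y (p ℕ.^ i)) ⟨
    pow F x (p ℕ.^ i) + pow F y (p ℕ.^ i)     ∎
    where
      p·1≡0 : p · 1# ≡ 0#
      p·1≡0 = trans (sym (ntimes≡· p 1#)) char-p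

  Additive : (Carrier → Carrier) → Set
  Additive φ = ∀ x y → φ (x + y) ≡ φ x + φ y

  evalAddAux-additive : ∀ i A → Additive (evalAddAux F i A)
  evalAddAux-additive i []       x y = sym (+-identityˡ 0#)
  evalAddAux-additive i (a ∷ as) x y = begin
    a * pow F (x + y) (p ℕ.^ i) + rest (x + y)
      ≡⟨ cong₂ (λ u v → a * u + v) (pow-p^-distrib-+ i x y) (evalAddAux-additive (suc i) as x y) ⟩
    a * (xᵢ + yᵢ) + (rest x + rest y)
      ≡⟨ cong (_+ (rest x + rest y)) (distribˡ a xᵢ yᵢ) ⟩
    (a * xᵢ + a * yᵢ) + (rest x + rest y)
      ≡⟨ interchange (a * xᵢ) (a * yᵢ) (rest x) (rest y) ⟩
    (a * xᵢ + rest x) + (a * yᵢ + rest y)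
      ∎
    where
      rest = evalAddAux F (suc i) as
      xᵢ = pow F x (p ℕ.^ i)
      yᵢ = pow F y (p ℕ.^ i)

  evalAdd-additive : ∀ A → Additive (evalAdd F A)
  evalAdd-additive = evalAddAux-additive 0

  module _ {φ : Carrier → Carrier} (φ-additive : Additive φ) where

    additive⇒φ0≡0 : φ 0# ≡ 0#
    additive⇒φ0≡0 = identityˡ-unique (φ 0#) (φ 0#) (trans (sym (φ-additive 0# 0#)) (cong φ (+-identityˡ 0#)))

    additive⇒φ[x-y]≡0 : ∀ {x y} → φ x ≡ φ y → φ (x + - y) ≡ 0#
    additive⇒φ[x-y]≡0 {x} {y} φx≡φy = identityˡ-unique (φ (x + - y)) (φ y) (begin
      φ (x + - y) + φ y     ≡⟨ φ-additive (x + - y) y ⟨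
      φ ((x + - y) + y)     ≡⟨ cong φ (//-rightDividesˡ y x) ⟩
      φ x                   ≡⟨ φx≡φy ⟩
      φ y                   ∎)

module Decomposition (F : FiniteField) (A B : AddPoly F) (g : Poly F)
  (AB≡BA : ∀ α → evalAdd F A (evalAdd F B α) ≡ evalAdd F B (evalAdd F A α)) where
  open FiniteField F using (Carrier; _+_; -_; 0#; enum)
  open ≡ using (refl; sym; trans; cong; cong₂)
  open ≡.≡-Reasoning
  open AdditivePolynomials F
  open FiniteType enum
  open CommutativeRing commutativeRing using (+-group)
  open import Algebra.Properties.Group +-group using (∙-cancelʳ; x∙y⁻¹≈ε⇒x≈y)

  f h : Carrier → Carrier
  f x = evalAdd F A x + eval F g (evalAdd F B x)
  h y = evalAdd F A y + evalAdd F B (eval F g y)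

  B∘f≡h∘B : ∀ x → evalAdd F B (f x) ≡ h (evalAdd F B x)
  B∘f≡h∘B x = begin
    evalAdd F B (evalAdd F A x + eval F g (evalAdd F B x))
      ≡⟨ evalAdd-additive B (evalAdd F A x) (eval F g (evalAdd F B x)) ⟩
    evalAdd F B (evalAdd F A x) + evalAdd F B (eval F g (evalAdd F B x))
      ≡⟨ cong (_+ evalAdd F B (eval F g (evalAdd F B x))) (AB≡BA x) ⟨
    evalAdd F A (evalAdd F B x) + evalAdd F B (eval F g (evalAdd F B x))
      ∎

  ker? : Decidable (ker F B)
  ker? x = evalAdd F B x ≟ 0#

  im? : Decidable (im F B)
  im? y = any? λ x → evalAdd F B x ≟ y

  whole? : Decidable (whole F)
  whole? _ = yes tt

  A-mapsTo-ker : MapsTo (ker F B) (evalAdd F A)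
  A-mapsTo-ker x Bx≡0 = begin
    evalAdd F B (evalAdd F A x)   ≡⟨ AB≡BA x ⟨
    evalAdd F A (evalAdd F B x)   ≡⟨ cong (evalAdd F A) Bx≡0 ⟩
    evalAdd F A 0#                ≡⟨ additive⇒φ0≡0 (evalAdd-additive A) ⟩
    0#                            ∎

  h-mapsTo-im : MapsTo (im F B) h
  h-mapsTo-im _ (x , refl) = f x , B∘f≡h∘B x

  f-mapsTo-whole : MapsTo (whole F) f
  f-mapsTo-whole _ _ = tt

  f-injective⇒A-injectiveOn-ker : InjectiveOn (whole F) f → InjectiveOn (ker F B) (evalAdd F A)
  f-injective⇒A-injectiveOn-ker f-injective x y Bx≡0 By≡0 Ax≡Ay =
    f-injective x y tt tt (cong₂ (λ u v → u + eval F g v) Ax≡Ay (trans Bx≡0 (sym By≡0)))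

  f-surjective⇒h-surjectiveOn-im : SurjectiveOn (whole F) f → SurjectiveOn (im F B) h
  f-surjective⇒h-surjectiveOn-im f-surjective _ (z , refl) =
    let x , _ , fx≡z = f-surjective z tt
    in  evalAdd F B x , (x , refl) , trans (sym (B∘f≡h∘B x)) (cong (evalAdd F B) fx≡z)

  injectiveOn-parts⇒f-injective : InjectiveOn (ker F B) (evalAdd F A) → InjectiveOn (im F B) h →
                                  InjectiveOn (whole F) f
  injectiveOn-parts⇒f-injective A-injective h-injective x y _ _ fx≡fy =
    x∙y⁻¹≈ε⇒x≈y x y (A-injective (x + - y) 0# B[x-y]≡0 (additive⇒φ0≡0 (evalAdd-additive B))
                                  (trans A[x-y]≡0 (sym (additive⇒φ0≡0 (evalAdd-additive A)))))
    where
      Bx≡By : evalAdd F B x ≡ evalAdd F B y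
      Bx≡By = h-injective _ _ (x , refl) (y , refl) (begin
        h (evalAdd F B x)   ≡⟨ B∘f≡h∘B x ⟨
        evalAdd F B (f x)   ≡⟨ cong (evalAdd F B) fx≡fy ⟩
        evalAdd F B (f y)   ≡⟨ B∘f≡h∘B y ⟩
        h (evalAdd F B y)   ∎)
      Ax≡Ay : evalAdd F A x ≡ evalAdd F A y
      Ax≡Ay = ∙-cancelʳ (eval F g (evalAdd F B x)) _ _
                (trans fx≡fy (cong (λ b → evalAdd F A y + eval F g b) (sym Bx≡By)))
      B[x-y]≡0 : evalAdd F B (x + - y) ≡ 0#
      B[x-y]≡0 = additive⇒φ[x-y]≡0 (evalAdd-additive B) Bx≡By
      A[x-y]≡0 : evalAdd F A (x + - y) ≡ 0#
      A[x-y]≡0 = additive⇒φ[x-y]≡0 (evalAdd-additive A) Ax≡Ay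

corollary3p3 : (F : FiniteField) → let open FiniteField F in
    (A B : AddPoly F) (g : Poly F) →
    (∀ α → evalAdd F A (evalAdd F B α) ≡ evalAdd F B (evalAdd F A α)) →
    Permutes F (whole F) (λ x → evalAdd F A x + eval F g (evalAdd F B x))
      ⇔ (Permutes F (ker F B) (evalAdd F A)
          × Permutes F (im F B) (λ x → evalAdd F A x + evalAdd F B (eval F g x)))
corollary3p3 F A B g AB≡BA = mk⇔ permutes⇒parts parts⇒permutes
  where
    open Decomposition F A B g AB≡BA
    open FiniteType (FiniteField.enum F) using (injectiveOn⇒surjectiveOn; surjectiveOn⇒injectiveOn)

    permutes⇒parts : Permutes F (whole F) f → Permutes F (ker F B) (evalAdd F A) × Permutes F (im F B) h
    permutes⇒parts (_ , f-injective , f-surjective) =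
      let A-injective  = f-injective⇒A-injectiveOn-ker f-injective
          h-surjective = f-surjective⇒h-surjectiveOn-im f-surjective
      in  (A-mapsTo-ker , A-injective , injectiveOn⇒surjectiveOn ker? A-mapsTo-ker A-injective)
        , (h-mapsTo-im , surjectiveOn⇒injectiveOn im? h-mapsTo-im h-surjective , h-surjective)

    parts⇒permutes : Permutes F (ker F B) (evalAdd F A) × Permutes F (im F B) h → Permutes F (whole F) f
    parts⇒permutes ((_ , A-injective , _) , (_ , h-injective , _)) =
      let f-injective = injectiveOn-parts⇒f-injective A-injective h-injective
      in  f-mapsTo-whole , f-injective , injectiveOn⇒surjectiveOn whole? f-mapsTo-whole f-injective
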